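{- Let $m \geq 3$ be an integer, let $\mathcal{A}$ be a set with a strict linear order $<$, and let $\mathcal{B}$ be a weakly $(m-1)$-wise balanced design over $\mathcal{A}$. Then the graph $\Gamma_{\mathcal{B}, m}$ contains no clique of size $m$.
   Context: For an integer $r \geq 2$ and a set $\mathcal{A}$ (whose elements are called points), a weakly $r$-wise balanced design over $\mathcal{A}$ is a family $\mathcal{B}$ of subsets of $\mathcal{A}$ (called blocks) such that: (1) any $r$ pairwise distinct points are contained together in at most one block; (2) every point lies in at least one block; (3) every block is non-empty. Given $m \geq 3$, a weakly $(m-1)$-wise balanced design $\mathcal{B}$ over $\mathcal{A}$, and a strict linear order $<$ on $\mathcal{A}$, the graph $\Gamma_{\mathcal{B}, m}$ has as vertices all incidence pairs $(x, B)$ with $B \in \mathcal{B}$ and $x \in B$; two vertices $(x, B_1)$ and $(y, B_2)$ are adjacent iff $x < y$, $B_1 \neq B_2$, and $x \in B_2$. -}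

module Defs where

open import Data.Nat using (ℕ)
open import Data.Fin using (Fin)
open import Data.Product using (Σ; ∃; _×_)
open import Data.Sum using (_⊎_)
open import Relation.Binary.PropositionalEquality using (_≡_; _≢_)
open import Relation.Nullary using (¬_)
open import Function.Definitions using (Injective)

-- A design over the point type A with blocks indexed by the type I;
-- x ∈ b means point x lies in block b.  Distinct blocks = distinct indices.
record WeaklyBalanced (r : ℕ) (A I : Set) (_∈_ : A → I → Set) : Set where
  field
    atMostOne : (xs : Fin r → A) → Injective _≡_ _≡_ xs →
                (b c : I) → (∀ k → xs k ∈ b) → (∀ k → xs k ∈ c) → b ≡ c
    covered : (x : A) → ∃ λ b → x ∈ b
    nonEmpty : (b : I) → ∃ λ x → x ∈ b

Vertex : (A I : Set) (_∈_ : A → I → Set) → Set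
Vertex A I _∈_ = Σ A λ x → Σ I λ b → x ∈ b

Arc : {A I : Set} {_∈_ : A → I → Set} (_<_ : A → A → Set) →
      Vertex A I _∈_ → Vertex A I _∈_ → Set
Arc {_∈_ = _∈_} _<_ (x Data.Product., b₁ Data.Product., _) (y Data.Product., b₂ Data.Product., _) =
  (x < y) × (b₁ ≢ b₂) × (x ∈ b₂)

Adjacent : {A I : Set} {_∈_ : A → I → Set} (_<_ : A → A → Set) →
           Vertex A I _∈_ → Vertex A I _∈_ → Set
Adjacent _<_ v w = Arc _<_ v w ⊎ Arc _<_ w v

Clique : {A I : Set} {_∈_ : A → I → Set} (_<_ : A → A → Set) → ℕ → Set
Clique {A} {I} {_∈_} _<_ n =
  Σ (Fin n → Vertex A I _∈_) λ f →
    Injective _≡_ _≡_ f × (∀ k l → k ≢ l → Adjacent _<_ (f k) (f l))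

{-# OPTIONS --safe #-}
module Submission where

open import Defs
open import Data.Nat using (ℕ; _≤_; _∸_; suc; zero; s≤s)
open import Relation.Binary.PropositionalEquality using (_≡_; _≢_; refl; sym; subst)
open import Relation.Binary.Structures using (IsStrictTotalOrder)
open import Relation.Binary.Definitions using (tri<; tri≈; tri>)
open import Relation.Nullary using (¬_; yes; no)
open import Data.Fin using (Fin; punchIn) renaming (zero to fz; suc to fs)
open import Data.Fin.Properties using (punchInᵢ≢i; punchIn-injective) renaming (_≟_ to _≟F_)
open import Data.Product using (Σ; _,_; proj₁; proj₂)
open import Data.Sum using (inj₁; inj₂)
open import Data.Empty using (⊥-elim)
open import Function using (_∘_)
open import Function.Definitions using (Injective)

-- An edge puts the smaller point into the block of the other vertex, so the clique
-- vertex with the largest point has all clique points in its block. Among the other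
-- m - 1 vertices, the one with the largest point likewise has their m - 1 (distinct)
-- points in its block. Adjacent vertices have distinct blocks, contradicting (1).

module _ {A : Set} {_<_ : A → A → Set} (sto : IsStrictTotalOrder _≡_ _<_) where
  open IsStrictTotalOrder sto using (compare; irrefl; trans; asym)

  IsMaximalAt : {n : ℕ} → (Fin n → A) → Fin n → Set
  IsMaximalAt f j = ∀ k → ¬ (f j < f k)

  argmax : (n : ℕ) (f : Fin (suc n) → A) → Σ (Fin (suc n)) (IsMaximalAt f)
  argmax zero f = fz , λ { fz p → irrefl refl p }
  argmax (suc n) f with argmax n (f ∘ fs)
  ... | j , h with compare (f fz) (f (fs j))
  ... | tri< a _ _ = fs j , λ { fz p → asym a p ; (fs k) p → h k p }
  ... | tri≈ _ e _ = fz , λ { fz p → irrefl refl p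
                            ; (fs k) p → h k (subst (_< f (fs k)) e p) }
  ... | tri> _ _ c = fz , λ { fz p → irrefl refl p ; (fs k) p → h k (trans c p) }

  module _ {I : Set} {_∈_ : A → I → Set} where

    point : Vertex A I _∈_ → A
    point = proj₁

    block : Vertex A I _∈_ → I
    block = proj₁ ∘ proj₂

    point∈block : (v : Vertex A I _∈_) → point v ∈ block v
    point∈block = proj₂ ∘ proj₂

    Adj : Vertex A I _∈_ → Vertex A I _∈_ → Set
    Adj = Adjacent {A} {I} {_∈_} _<_

    PairwiseAdjacent : {n : ℕ} → (Fin n → Vertex A I _∈_) → Set
    PairwiseAdjacent f = ∀ k l → k ≢ l → Adj (f k) (f l)

    adjacent⇒points≢ : ∀ v w → Adj v w → point v ≢ point w
    adjacent⇒points≢ _ _ (inj₁ (v<w , _)) e = irrefl e v<w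
    adjacent⇒points≢ _ _ (inj₂ (w<v , _)) e = irrefl (sym e) w<v

    adjacent⇒blocks≢ : ∀ v w → Adj v w → block v ≢ block w
    adjacent⇒blocks≢ _ _ (inj₁ (_ , b≢ , _)) = b≢
    adjacent⇒blocks≢ _ _ (inj₂ (_ , b≢ , _)) = b≢ ∘ sym

    adjacent∧≯⇒point∈block : ∀ v w → Adj v w → ¬ (point w < point v) → point v ∈ block w
    adjacent∧≯⇒point∈block _ _ (inj₁ (_ , _ , v∈w)) _ = v∈w
    adjacent∧≯⇒point∈block _ _ (inj₂ (w<v , _))    w≯v = ⊥-elim (w≯v w<v)

    pairwiseAdjacent-∘ : ∀ {m n} (f : Fin n → Vertex A I _∈_) {g : Fin m → Fin n} →
                         PairwiseAdjacent f → Injective _≡_ _≡_ g → PairwiseAdjacent (f ∘ g)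
    pairwiseAdjacent-∘ _ adj g-inj k l k≢l = adj _ _ (k≢l ∘ g-inj)

    pairwiseAdjacent⇒points-injective : ∀ {n} (f : Fin n → Vertex A I _∈_) →
                                        PairwiseAdjacent f → Injective _≡_ _≡_ (point ∘ f)
    pairwiseAdjacent⇒points-injective f adj {k} {l} e with k ≟F l
    ... | yes k≡l = k≡l
    ... | no  k≢l = ⊥-elim (adjacent⇒points≢ (f k) (f l) (adj k l k≢l) e)

    pairwiseAdjacent⇒points∈maximal-block :
      ∀ {n} (f : Fin n → Vertex A I _∈_) {j} → PairwiseAdjacent f →
      IsMaximalAt (point ∘ f) j → ∀ k → point (f k) ∈ block (f j)
    pairwiseAdjacent⇒points∈maximal-block f {j} adj max k with k ≟F j
    ... | yes refl = point∈block (f j)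
    ... | no  k≢j  = adjacent∧≯⇒point∈block (f k) (f j) (adj k j k≢j) (max k)

    clique-free : (n : ℕ) → WeaklyBalanced (suc n) A I _∈_ → ¬ Clique {A} {I} {_∈_} _<_ (suc (suc n))
    clique-free n wb (f , _ , adj) =
      adjacent⇒blocks≢ (f top) (f (punchIn top s)) (adj top (punchIn top s) (punchInᵢ≢i top s ∘ sym))
        (WeaklyBalanced.atMostOne wb (point ∘ rest)
          (pairwiseAdjacent⇒points-injective rest adj-rest) _ _
          (pairwiseAdjacent⇒points∈maximal-block f adj top-max ∘ punchIn top)
          (pairwiseAdjacent⇒points∈maximal-block rest adj-rest s-max))
      where
      top : Fin (suc (suc n))
      top = proj₁ (argmax (suc n) (point ∘ f))
      top-max : IsMaximalAt (point ∘ f) top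
      top-max = proj₂ (argmax (suc n) (point ∘ f))
      rest : Fin (suc n) → Vertex A I _∈_
      rest = f ∘ punchIn top
      adj-rest : PairwiseAdjacent rest
      adj-rest = pairwiseAdjacent-∘ f adj (punchIn-injective top _ _)
      s : Fin (suc n)
      s = proj₁ (argmax n (point ∘ rest))
      s-max : IsMaximalAt (point ∘ rest) s
      s-max = proj₂ (argmax n (point ∘ rest))

theorem2p3 : (m : ℕ) → 3 ≤ m →
    (A : Set) (_<_ : A → A → Set) → IsStrictTotalOrder _≡_ _<_ →
    (I : Set) (_∈_ : A → I → Set) → WeaklyBalanced (m ∸ 1) A I _∈_ →
    ¬ Clique {A} {I} {_∈_} _<_ m
theorem2p3 (suc (suc (suc n))) (s≤s (s≤s (s≤s _))) A _<_ sto I _∈_ =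
  clique-free sto (suc n)
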